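{- Let $K$ be a number field, let $\ell\geq 2$, let $n_1>n_2>\cdots>n_\ell\geq 1$ be integers and set $n_{\ell+1}:=0$. Let $a_1,\ldots,a_{\ell+1}\in K$ with $a_1\cdots a_\ell\neq 0$, and let $e_1,e_0,c_1,c_0,\alpha\in K$ with $e_1c_1\alpha\neq 0$. Assume that \[ a_1x^{n_1}+\cdots+a_{\ell}x^{n_{\ell}}+a_{\ell+1}=e_1D_{n_1}(c_1x+c_0,\alpha)+e_0. \] Then $n_{i-1}-n_{i}\leq 2$ for all $i=2,3,\ldots,\ell+1$, and hence $n_1\leq 2\ell$.
   Context: For $n\in\mathbb{N}$ and $a\in K$, the $n$-th Dickson polynomial with parameter $a$ is \[ D_n(x,a)=\sum_{j=0}^{\lfloor n/2 \rfloor} \frac{n}{n-j} \binom{n-j}{j} (-a)^{j} x^{n-2j}. \] -}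

module Defs where

open import Level using (Level; _⊔_)
open import Algebra.Bundles using (CommutativeRing)
open import Data.Nat as ℕ using (ℕ; zero; suc; _∸_; _/_)
open import Data.Nat.Combinatorics using (_C_)
open import Data.Integer as ℤ using (ℤ; +_; -[1+_])
open import Data.Rational using (ℚ; ↥_; ↧ₙ_)
open import Data.Fin using (Fin)
import Data.Fin as Fin
open import Data.List using (List; []; _∷_)
open import Data.Product using (Σ; ∃; _×_)
open import Relation.Nullary using (¬_)

module Over {c ℓ} (R : CommutativeRing c ℓ) where
  open CommutativeRing R

  ιℕ : ℕ → Carrier
  ιℕ zero    = 0#
  ιℕ (suc n) = 1# + ιℕ n

  ιℤ : ℤ → Carrier
  ιℤ (+ n)     = ιℕ n
  ιℤ -[1+ n ]  = - ιℕ (suc n)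

  pow : Carrier → ℕ → Carrier
  pow x zero    = 1#
  pow x (suc n) = x * pow x n

  ΣFin : (d : ℕ) → (Fin d → Carrier) → Carrier
  ΣFin zero    f = 0#
  ΣFin (suc d) f = f Fin.zero + ΣFin d (λ i → f (Fin.suc i))

  prodFrom : ℕ → ℕ → (ℕ → Carrier) → Carrier
  prodFrom lo zero    f = 1#
  prodFrom lo (suc k) f = f lo * prodFrom (suc lo) k f

  prod : ℕ → ℕ → (ℕ → Carrier) → Carrier
  prod lo hi f = prodFrom lo (suc hi ∸ lo) f

  -- Univariate polynomials R[x] as coefficient lists (constant term first);
  -- equality is coefficientwise (so trailing zeros are irrelevant).

  Poly : Set c
  Poly = List Carrier

  coeff : Poly → ℕ → Carrier
  coeff []       _       = 0#
  coeff (a ∷ p)  zero    = a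
  coeff (a ∷ p)  (suc i) = coeff p i

  _≈ₚ_ : Poly → Poly → Set ℓ
  p ≈ₚ q = ∀ i → coeff p i ≈ coeff q i

  infixl 6 _⊕_
  infixl 7 _⊗_ _·ₚ_

  _⊕_ : Poly → Poly → Poly
  []      ⊕ q       = q
  (a ∷ p) ⊕ []      = a ∷ p
  (a ∷ p) ⊕ (b ∷ q) = (a + b) ∷ (p ⊕ q)

  _·ₚ_ : Carrier → Poly → Poly
  k ·ₚ []      = []
  k ·ₚ (a ∷ p) = (k * a) ∷ (k ·ₚ p)

  _⊗_ : Poly → Poly → Poly
  []      ⊗ q = []
  (a ∷ p) ⊗ q = (a ·ₚ q) ⊕ (0# ∷ (p ⊗ q))

  constP : Carrier → Poly
  constP a = a ∷ []

  X : Poly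
  X = 0# ∷ 1# ∷ []

  powP : Poly → ℕ → Poly
  powP p zero    = constP 1#
  powP p (suc n) = p ⊗ powP p n

  sumPFrom : ℕ → ℕ → (ℕ → Poly) → Poly
  sumPFrom lo zero    f = []
  sumPFrom lo (suc k) f = f lo ⊕ sumPFrom (suc lo) k f

  sumP : ℕ → ℕ → (ℕ → Poly) → Poly
  sumP lo hi f = sumPFrom lo (suc hi ∸ lo) f

  -- The integer  n/(n-j) * binom(n-j, j)  (for 0 ≤ j ≤ ⌊n/2⌋, n ≥ 1, it is an
  -- integer); computed as the exact natural-number quotient  n*binom(n-j,j)/(n-j).
  -- (When n - j = 0, i.e. n = j = 0, we return 0; this case never arises below.)
  dicksonCoeff : ℕ → ℕ → ℕ
  dicksonCoeff n j with n ∸ j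
  ... | zero  = 0
  ... | suc m = (n ℕ.* (suc m C j)) / suc m

  D : ℕ → Poly → Carrier → Poly
  D n p a = sumP 0 (n / 2)
              (λ j → (ιℕ (dicksonCoeff n j) * pow (- a) j) ·ₚ powP p (n ∸ 2 ℕ.* j))

-- Number fields: commutative rings that are fields, of characteristic 0,
-- and finite-dimensional as vector spaces over ℚ (via the canonical
-- embedding ℚ → K).

record NumberField (c ℓ : Level) : Set (Level.suc (c ⊔ ℓ)) where
  field
    commRing : CommutativeRing c ℓ
  open CommutativeRing commRing public
  field
    nontrivial : ¬ (1# ≈ 0#)
    _⁻¹        : Carrier → Carrier
    inverseʳ   : ∀ x → ¬ (x ≈ 0#) → x * (x ⁻¹) ≈ 1#
    char0      : ∀ n → ¬ (Over.ιℕ commRing (suc n) ≈ 0#)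

  ιℚ : ℚ → Carrier
  ιℚ q = Over.ιℤ commRing (↥ q) * (Over.ιℕ commRing (↧ₙ q) ⁻¹)

  field
    finiteDim : Σ ℕ λ d → Σ (Fin d → Carrier) λ b →
                  ∀ x → Σ (Fin d → ℚ) λ q → x ≈ Over.ΣFin commRing d (λ i → ιℚ (q i) * b i)

module Submission where

-- Write y = b₀ + b₁x and F = D_N(y, α), N = n₁.  The Dickson polynomial
-- solves (Y² - 4α)D″ + YD′ = N²D; in the variable x this is 𝕃F = (b₁N)²F + 4αF″
-- with 𝕃f = y·(y·f′)′.  We prove it from D_N = Σ_j w_j y^{N-2j}: powers of y are
-- eigenvectors of 𝕃, and the weights satisfy a two-term recurrence coming from
-- the ratio of consecutive Dickson coefficients, so the sum telescopes.  Read on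
-- coefficients, the equation determines F_{k+2} from F_k, F_{k+1} (if b₀² ≠ 4α),
-- resp. F_{k+1} from F_k (if b₀² = 4α); so two consecutive zero coefficients
-- would force the leading coefficient to vanish.  A gap n_{i-1} - n_i ≥ 3 yields
-- such a pair; summing gaps down to n_{l+1} = 0 gives n₁ ≤ 2l.

open import Level using (_⊔_)
open import Algebra.Bundles using (CommutativeRing)
open import Data.Nat as ℕ using (ℕ; zero; suc; _≤_; _<_; _∸_; s≤s; z≤n)
import Data.Nat.Properties as ℕₚ
open import Data.List using ([]; _∷_)
open import Data.Product using (_×_; _,_; proj₁; proj₂)
open import Data.Sum using (inj₁; inj₂)
open import Data.Empty using (⊥; ⊥-elim)
open import Relation.Nullary using (¬_)
open import Relation.Nullary.Decidable using (decidable-stable)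
import Relation.Binary.PropositionalEquality as P
open import Relation.Binary.PropositionalEquality using (_≡_; _≢_)
open import Defs

-- Binomial coefficients: the two absorption identities used to relate
-- consecutive Dickson coefficients.
module Binomials where
  open import Data.Nat
  open import Data.Nat.Properties
  open import Data.Nat.Combinatorics using (_C_; nC1≡n; nCk≡nC[n∸k]; nCk+nC[k+1]≡[n+1]C[k+1])
  open import Data.Nat.Tactic.RingSolver using (solve-∀)
  open P using (refl; sym; trans; cong; cong₂; module ≡-Reasoning)

  absorption : ∀ n k → suc k * (suc n C suc k) ≡ suc n * (n C k)
  absorption zero    zero    = refl
  absorption zero    (suc k) = *-zeroʳ (suc (suc k))
  absorption (suc n) zero    =
    trans (+-identityʳ _) (trans (nC1≡n (suc (suc n))) (sym (*-identityʳ (suc (suc n)))))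
  absorption (suc n) (suc k) = begin
      suc (suc k) * (suc (suc n) C suc (suc k))
    ≡⟨ cong (suc (suc k) *_) (sym (nCk+nC[k+1]≡[n+1]C[k+1] (suc n) (suc k))) ⟩
      suc (suc k) * (c + c′)
    ≡⟨ expand (suc k) c c′ ⟩
      suc k * c + c + suc (suc k) * c′
    ≡⟨ cong₂ (λ x y → x + c + y) (absorption n k) (absorption n (suc k)) ⟩
      suc n * (n C k) + c + suc n * (n C suc k)
    ≡⟨ collect (suc n) (n C k) (n C suc k) c ⟩
      suc n * (n C k + n C suc k) + c
    ≡⟨ cong (λ x → suc n * x + c) (nCk+nC[k+1]≡[n+1]C[k+1] n k) ⟩
      suc n * c + c
    ≡⟨ +-comm (suc n * c) c ⟩
      suc (suc n) * c
    ∎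
    where
    open ≡-Reasoning
    c c′ : ℕ
    c = suc n C suc k
    c′ = suc n C suc (suc k)
    expand : ∀ k a b → suc k * (a + b) ≡ k * a + a + suc k * b
    expand = solve-∀
    collect : ∀ n a b c → n * a + c + n * b ≡ n * (a + b) + c
    collect = solve-∀

  absorption-complement : ∀ m i → suc m * (suc (m + i) C i) ≡ suc (m + i) * ((m + i) C i)
  absorption-complement m i = begin
      suc m * (suc (m + i) C i)
    ≡⟨ cong (suc m *_) (trans (nCk≡nC[n∸k] (m≤n+m i (suc m))) (cong (suc (m + i) C_) (m+n∸n≡m (suc m) i))) ⟩
      suc m * (suc (m + i) C suc m)
    ≡⟨ absorption (m + i) m ⟩
      suc (m + i) * ((m + i) C m)
    ≡⟨ cong (suc (m + i) *_) (sym (trans (nCk≡nC[n∸k] (m≤n+m i m)) (cong ((m + i) C_) (m+n∸n≡m m i)))) ⟩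
      suc (m + i) * ((m + i) C i)
    ∎
    where open ≡-Reasoning

-- The Dickson coefficient d(N,j) = N/(N-j)·C(N-j,j).  Defs defines it (as an
-- exact quotient) inside the module Over, so the ring R is a mere formal
-- parameter here.
module DicksonCoefficients {c ℓ} (R : CommutativeRing c ℓ) where
  open import Data.Nat
  open import Data.Nat.Properties
  open import Data.Nat.Combinatorics using (_C_)
  open import Data.Nat.DivMod using (m*n/n≡m)
  open import Data.Nat.Tactic.RingSolver using (solve-∀)
  open P using (refl; sym; trans; cong; subst; module ≡-Reasoning)
  open Over R using (dicksonCoeff)
  open Binomials

  dicksonCoeff-unfold : ∀ N j t → N ∸ j ≡ suc t → dicksonCoeff N j ≡ (N * (suc t C j)) / suc t
  dicksonCoeff-unfold N j t e with N ∸ j | e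
  ... | .(suc t) | refl = refl

  -- The value of d(t+1+j, j), namely C(t+1,j) + C(t,j-1).
  dicksonValue : ℕ → ℕ → ℕ
  dicksonValue t zero    = 1
  dicksonValue t (suc i) = suc t C suc i + t C i

  -- The division defining d(N,j) is exact:  N·C(N-j,j) = (N-j)·dicksonValue.
  dicksonValue-spec : ∀ t j → (suc t + j) * (suc t C j) ≡ dicksonValue t j * suc t
  dicksonValue-spec t zero =
    trans (*-identityʳ (suc t + 0)) (trans (+-identityʳ (suc t)) (sym (*-identityˡ (suc t))))
  dicksonValue-spec t (suc i) = begin
      (suc t + suc i) * (suc t C suc i)
    ≡⟨ *-distribʳ-+ (suc t C suc i) (suc t) (suc i) ⟩
      suc t * (suc t C suc i) + suc i * (suc t C suc i)
    ≡⟨ cong (suc t * (suc t C suc i) +_) (absorption t i) ⟩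
      suc t * (suc t C suc i) + suc t * (t C i)
    ≡⟨ sym (*-distribˡ-+ (suc t) (suc t C suc i) (t C i)) ⟩
      suc t * dicksonValue t (suc i)
    ≡⟨ *-comm (suc t) _ ⟩
      dicksonValue t (suc i) * suc t
    ∎
    where open ≡-Reasoning

  dicksonCoeff-spec : ∀ t j → suc t * dicksonCoeff (suc t + j) j ≡ (suc t + j) * (suc t C j)
  dicksonCoeff-spec t j = begin
      suc t * dicksonCoeff (suc t + j) j
    ≡⟨ cong (suc t *_) (dicksonCoeff-unfold (suc t + j) j t (m+n∸n≡m (suc t) j)) ⟩
      suc t * (((suc t + j) * (suc t C j)) / suc t)
    ≡⟨ cong (λ x → suc t * (x / suc t)) (dicksonValue-spec t j) ⟩
      suc t * ((dicksonValue t j * suc t) / suc t)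
    ≡⟨ cong (suc t *_) (m*n/n≡m (dicksonValue t j) (suc t)) ⟩
      suc t * dicksonValue t j
    ≡⟨ *-comm (suc t) (dicksonValue t j) ⟩
      dicksonValue t j * suc t
    ≡⟨ sym (dicksonValue-spec t j) ⟩
      (suc t + j) * (suc t C j)
    ∎
    where open ≡-Reasoning

  -- Ratio of consecutive Dickson coefficients: for N = m+2j+2,
  --   d(N,j+1)·(j+1)(m+j+1) = d(N,j)·(m+2)(m+1).
  -- Both sides times (m+j+2) equal N·(m+j+2)(m+j+1)·C(m+j,j).
  dicksonCoeff-recurrence : ∀ m j → dicksonCoeff (suc (m + j) + suc j) (suc j) * (suc j * suc (m + j))
                                  ≡ dicksonCoeff (suc (m + j) + suc j) j * (suc (suc m) * suc m)
  dicksonCoeff-recurrence m j = *-cancelʳ-≡ _ _ s (begin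
      d′ * (suc j * s′) * s
    ≡⟨ r₁ d′ (suc j) s′ s ⟩
      s′ * d′ * suc j * s
    ≡⟨ cong (λ x → x * suc j * s) (dicksonCoeff-spec (m + j) (suc j)) ⟩
      N * (s′ C suc j) * suc j * s
    ≡⟨ r₂ N (s′ C suc j) (suc j) s ⟩
      N * (suc j * (s′ C suc j)) * s
    ≡⟨ cong (λ x → N * x * s) (absorption (m + j) j) ⟩
      N * (s′ * ((m + j) C j)) * s
    ≡⟨ r₃ N s′ ((m + j) C j) s ⟩
      N * (s * (s′ * ((m + j) C j)))
    ≡⟨ cong (λ x → N * (s * x)) (sym (absorption-complement m j)) ⟩
      N * (s * (suc m * (s′ C j)))
    ≡⟨ r₄ N s (suc m) (s′ C j) ⟩
      N * ((s * (s′ C j)) * suc m)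
    ≡⟨ cong (λ x → N * (x * suc m)) (sym (absorption-complement (suc m) j)) ⟩
      N * ((suc (suc m) * (s C j)) * suc m)
    ≡⟨ r₅ N (suc (suc m)) (s C j) (suc m) ⟩
      N * (s C j) * (suc (suc m) * suc m)
    ≡⟨ cong (_* (suc (suc m) * suc m)) (sym spec′) ⟩
      s * d * (suc (suc m) * suc m)
    ≡⟨ r₆ s d (suc (suc m) * suc m) ⟩
      d * (suc (suc m) * suc m) * s
    ∎)
    where
    open ≡-Reasoning
    s′ s N d′ d : ℕ
    s′ = suc (m + j)
    s = suc (suc (m + j))
    N = suc (m + j) + suc j
    d′ = dicksonCoeff N (suc j)
    d = dicksonCoeff N j
    N≡ : N ≡ s + j
    N≡ = +-suc (suc (m + j)) j
    spec′ : s * d ≡ N * (s C j)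
    spec′ = subst (λ z → s * dicksonCoeff z j ≡ z * (s C j)) (sym N≡) (dicksonCoeff-spec (suc (m + j)) j)
    r₁ : ∀ a b c e → a * (b * c) * e ≡ c * a * b * e
    r₁ = solve-∀
    r₂ : ∀ a b c e → a * b * c * e ≡ a * (c * b) * e
    r₂ = solve-∀
    r₃ : ∀ a b c e → a * (b * c) * e ≡ a * (e * (b * c))
    r₃ = solve-∀
    r₄ : ∀ a b c e → a * (b * (c * e)) ≡ a * ((b * e) * c)
    r₄ = solve-∀
    r₅ : ∀ a b c e → a * ((b * c) * e) ≡ a * c * (b * e)
    r₅ = solve-∀
    r₆ : ∀ a b c → a * b * c ≡ b * c * a
    r₆ = solve-∀

module HalfIndex where
  open import Data.Nat
  open import Data.Nat.Properties
  open import Data.Nat.DivMod using (m%n<n; m≡m%n+[m/n]*n; m/n*n≤m)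
  open import Data.Nat.Tactic.RingSolver using (solve-∀)
  open P using (sym; trans; cong; subst)

  remainder<2 : ∀ N → N ∸ 2 * (N / 2) < 2
  remainder<2 N = subst (_< 2) (sym N∸2J≡N%2) (m%n<n N 2)
    where
    N∸2J≡N%2 : N ∸ 2 * (N / 2) ≡ N % 2
    N∸2J≡N%2 = trans (cong (_∸ 2 * (N / 2)) (trans (m≡m%n+[m/n]*n N 2) (cong (N % 2 +_) (*-comm (N / 2) 2))))
                     (m+n∸n≡m (N % 2) (2 * (N / 2)))

  module BelowHalf (N j : ℕ) (j<J : suc j ≤ N / 2) where
    m : ℕ
    m = N ∸ 2 * suc j

    N≡m+2[j+1] : N ≡ m + 2 * suc j
    N≡m+2[j+1] = sym (m∸n+n≡m (≤-trans (*-monoʳ-≤ 2 j<J) (subst (_≤ N) (*-comm (N / 2) 2) (m/n*n≤m N 2))))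

    N≡ : N ≡ suc (m + j) + suc j
    N≡ = trans N≡m+2[j+1] (regroup m j)
      where
      regroup : ∀ m j → m + 2 * suc j ≡ suc (m + j) + suc j
      regroup = solve-∀

    N∸2j≡m+2 : N ∸ 2 * j ≡ suc (suc m)
    N∸2j≡m+2 = trans (cong (_∸ 2 * j) (trans N≡m+2[j+1] (regroup m j))) (m+n∸n≡m (suc (suc m)) (2 * j))
      where
      regroup : ∀ m j → m + 2 * suc j ≡ suc (suc m) + 2 * j
      regroup = solve-∀

-- Coefficient calculus over an arbitrary commutative ring R.
module RingTheory {c ℓ} (R : CommutativeRing c ℓ) where
  open CommutativeRing R hiding (zero)
  open Over R
  open import Relation.Binary.Reasoning.Setoid setoid
  open import Algebra.Solver.Ring.NaturalCoefficients.Default commutativeSemiring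
  open import Algebra.Properties.CommutativeSemigroup *-commutativeSemigroup using (x∙yz≈y∙xz)
  open import Algebra.Properties.Ring ring using (-‿distribˡ-*)
  open import Algebra.Properties.Group +-group using (∙-cancelʳ)

  ι : ℕ → Carrier
  ι = ιℕ

  ι-+ : ∀ a b → ι (a ℕ.+ b) ≈ ι a + ι b
  ι-+ zero    b = sym (+-identityˡ _)
  ι-+ (suc a) b = trans (+-congˡ (ι-+ a b)) (sym (+-assoc _ _ _))

  ι-* : ∀ a b → ι (a ℕ.* b) ≈ ι a * ι b
  ι-* zero    b = sym (zeroˡ _)
  ι-* (suc a) b = begin
      ι (b ℕ.+ a ℕ.* b)
    ≈⟨ trans (ι-+ b (a ℕ.* b)) (+-congˡ (ι-* a b)) ⟩
      ι b + ι a * ι b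
    ≈⟨ solve 2 (λ x y → y :+ x :* y := (con 1 :+ x) :* y) refl (ι a) (ι b) ⟩
      (1# + ι a) * ι b
    ∎

  -- The constant 4, written as the ring solver writes it.
  four : Carrier
  four = 1# + 1# + 1# + 1#

  x≈0⇒x*y≈0 : ∀ {x} y → x ≈ 0# → x * y ≈ 0#
  x≈0⇒x*y≈0 y e = trans (*-congʳ e) (zeroˡ y)

  y≈0⇒x*y≈0 : ∀ x {y} → y ≈ 0# → x * y ≈ 0#
  y≈0⇒x*y≈0 x e = trans (*-congˡ e) (zeroʳ x)

  factors≉0 : ∀ {x y} → ¬ (x * y ≈ 0#) → ¬ (x ≈ 0#) × ¬ (y ≈ 0#)
  factors≉0 {x} {y} xy≉0 = (λ e → xy≉0 (x≈0⇒x*y≈0 y e)) , (λ e → xy≉0 (y≈0⇒x*y≈0 x e))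

  prodFrom-head≈0 : ∀ lo k (f : ℕ → Carrier) → 1 ≤ k → f lo ≈ 0# → prodFrom lo k f ≈ 0#
  prodFrom-head≈0 lo (suc k) f _ e = x≈0⇒x*y≈0 _ e

  coeff-⊕ : ∀ p q i → coeff (p ⊕ q) i ≈ coeff p i + coeff q i
  coeff-⊕ []      q       i       = sym (+-identityˡ _)
  coeff-⊕ (a ∷ p) []      i       = sym (+-identityʳ _)
  coeff-⊕ (a ∷ p) (b ∷ q) zero    = refl
  coeff-⊕ (a ∷ p) (b ∷ q) (suc i) = coeff-⊕ p q i

  coeff-· : ∀ k p i → coeff (k ·ₚ p) i ≈ k * coeff p i
  coeff-· k []      i       = sym (zeroʳ k)
  coeff-· k (a ∷ p) zero    = refl
  coeff-· k (a ∷ p) (suc i) = coeff-· k p i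

  -- Coefficient sequences of x·f: shift up by one.
  shift : (ℕ → Carrier) → ℕ → Carrier
  shift s zero    = 0#
  shift s (suc i) = s i

  shift-scaled : ∀ {s t : ℕ → Carrier} x → (∀ k → s k ≈ x * t k) → ∀ k → shift s k ≈ x * shift t k
  shift-scaled x e zero    = sym (zeroʳ x)
  shift-scaled x e (suc k) = e k

  coeff-linear : ∀ b₀ b₁ q i → coeff ((b₀ ∷ b₁ ∷ []) ⊗ q) i ≈ b₀ * coeff q i + b₁ * shift (coeff q) i
  coeff-linear b₀ b₁ q i = trans (coeff-⊕ (b₀ ·ₚ q) _ i) (+-cong (coeff-· b₀ q i) (tail i))
    where
    tail : ∀ i → coeff (0# ∷ ((b₁ ·ₚ q) ⊕ (0# ∷ []))) i ≈ b₁ * shift (coeff q) i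
    tail zero    = sym (zeroʳ b₁)
    tail (suc i) = trans (coeff-⊕ (b₁ ·ₚ q) _ i)
                         (trans (+-congˡ (coeff-zero i)) (trans (+-identityʳ _) (coeff-· b₁ q i)))
      where
      coeff-zero : ∀ i → coeff (0# ∷ []) i ≈ 0#
      coeff-zero zero    = refl
      coeff-zero (suc i) = refl

  sumFrom : ℕ → ℕ → (ℕ → Carrier) → Carrier
  sumFrom lo zero    g = 0#
  sumFrom lo (suc n) g = g lo + sumFrom (suc lo) n g

  coeff-sumPFrom : ∀ lo n F i → coeff (sumPFrom lo n F) i ≈ sumFrom lo n (λ j → coeff (F j) i)
  coeff-sumPFrom lo zero    F i = refl
  coeff-sumPFrom lo (suc n) F i = trans (coeff-⊕ (F lo) _ i) (+-congˡ (coeff-sumPFrom (suc lo) n F i))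

  sumFrom-cong : ∀ lo n {g h : ℕ → Carrier} → (∀ j → g j ≈ h j) → sumFrom lo n g ≈ sumFrom lo n h
  sumFrom-cong lo zero    e = refl
  sumFrom-cong lo (suc n) e = +-cong (e lo) (sumFrom-cong (suc lo) n e)

  sumFrom-+ : ∀ lo n (g h : ℕ → Carrier) → sumFrom lo n (λ j → g j + h j) ≈ sumFrom lo n g + sumFrom lo n h
  sumFrom-+ lo zero    g h = sym (+-identityʳ _)
  sumFrom-+ lo (suc n) g h = trans (+-congˡ (sumFrom-+ (suc lo) n g h))
    (solve 4 (λ a b x y → (a :+ b) :+ (x :+ y) := (a :+ x) :+ (b :+ y)) refl (g lo) (h lo) _ _)

  sumFrom-* : ∀ lo n x (g : ℕ → Carrier) → sumFrom lo n (λ j → x * g j) ≈ x * sumFrom lo n g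
  sumFrom-* lo zero    x g = sym (zeroʳ x)
  sumFrom-* lo (suc n) x g = trans (+-congˡ (sumFrom-* (suc lo) n x g)) (sym (distribˡ x _ _))

  sumFrom-vanish : ∀ lo n (g : ℕ → Carrier) → (∀ j → lo ≤ j → j < lo ℕ.+ n → g j ≈ 0#) → sumFrom lo n g ≈ 0#
  sumFrom-vanish lo zero    g h = refl
  sumFrom-vanish lo (suc n) g h = trans (+-cong (h lo ℕₚ.≤-refl lo<end) rest) (+-identityʳ 0#)
    where
    end≡ : lo ℕ.+ suc n ≡ suc (lo ℕ.+ n)
    end≡ = ℕₚ.+-suc lo n
    lo<end : lo < lo ℕ.+ suc n
    lo<end = P.subst (lo <_) (P.sym end≡) (s≤s (ℕₚ.m≤m+n lo n))
    rest : sumFrom (suc lo) n g ≈ 0#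
    rest = sumFrom-vanish (suc lo) n g (λ j lo<j j< → h j (ℕₚ.<⇒≤ lo<j) (P.subst (j <_) (P.sym end≡) j<))

  sumFrom-snoc : ∀ lo n (g : ℕ → Carrier) → sumFrom lo (suc n) g ≈ sumFrom lo n g + g (lo ℕ.+ n)
  sumFrom-snoc lo zero    g = trans (+-identityʳ _)
    (trans (reflexive (P.cong g (P.sym (ℕₚ.+-identityʳ lo)))) (sym (+-identityˡ _)))
  sumFrom-snoc lo (suc n) g = trans (+-congˡ (sumFrom-snoc (suc lo) n g))
    (trans (sym (+-assoc _ _ _)) (+-congˡ (reflexive (P.cong g (P.sym (ℕₚ.+-suc lo n))))))

  sumFrom-telescope : ∀ J (u v t : ℕ → Carrier) → u 0 ≈ v 0 → (∀ j → j < J → u (suc j) ≈ v (suc j) + t j) →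
                      sumFrom 0 (suc J) u + t J ≈ sumFrom 0 (suc J) (λ j → v j + t j)
  sumFrom-telescope zero    u v t u₀≈v₀ step = trans (+-congʳ (+-congʳ u₀≈v₀))
    (solve 2 (λ b x → (b :+ con 0) :+ x := (b :+ x) :+ con 0) refl (v 0) (t 0))
  sumFrom-telescope (suc J) u v t u₀≈v₀ step = begin
      sumFrom 0 (suc (suc J)) u + t (suc J)
    ≈⟨ +-congʳ (trans (sumFrom-snoc 0 (suc J) u) (+-congˡ (step J (ℕₚ.n<1+n J)))) ⟩
      (sumFrom 0 (suc J) u + (v (suc J) + t J)) + t (suc J)
    ≈⟨ solve 4 (λ a b x y → (a :+ (b :+ x)) :+ y := (a :+ x) :+ (b :+ y)) refl (sumFrom 0 (suc J) u) (v (suc J)) (t J) (t (suc J)) ⟩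
      (sumFrom 0 (suc J) u + t J) + (v (suc J) + t (suc J))
    ≈⟨ +-congʳ (sumFrom-telescope J u v t u₀≈v₀ (λ j j<J → step j (ℕₚ.m<n⇒m<1+n j<J))) ⟩
      sumFrom 0 (suc J) (λ j → v j + t j) + (v (suc J) + t (suc J))
    ≈⟨ sym (sumFrom-snoc 0 (suc J) (λ j → v j + t j)) ⟩
      sumFrom 0 (suc (suc J)) (λ j → v j + t j)
    ∎

  record Linear (T : (ℕ → Carrier) → ℕ → Carrier) : Set (c ⊔ ℓ) where
    field
      cong  : ∀ {s s′ : ℕ → Carrier} → (∀ i → s i ≈ s′ i) → ∀ k → T s k ≈ T s′ k
      scale : ∀ x (s : ℕ → Carrier) k → T (λ i → x * s i) k ≈ x * T s k
      sum   : ∀ lo n (h : ℕ → ℕ → Carrier) k →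
              T (λ i → sumFrom lo n (λ j → h j i)) k ≈ sumFrom lo n (λ j → T (h j) k)

  ∘-linear : ∀ {T U} → Linear T → Linear U → Linear (λ s → T (U s))
  ∘-linear {T} {U} LT LU = record
    { cong  = λ e k → T.cong (U.cong e) k
    ; scale = λ x s k → trans (T.cong (λ i → U.scale x s i) k) (T.scale x (U s) k)
    ; sum   = λ lo n h k → trans (T.cong (λ i → U.sum lo n h i) k) (T.sum lo n (λ j → U (h j)) k)
    }
    where
    module T = Linear LT
    module U = Linear LU

  linear-expansion : ∀ {T} → Linear T → ∀ lo n (x : ℕ → Carrier) (s : ℕ → ℕ → Carrier) {f : ℕ → Carrier} →
                     (∀ i → f i ≈ sumFrom lo n (λ j → x j * s j i)) →
                     ∀ k → T f k ≈ sumFrom lo n (λ j → x j * T (s j) k)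
  linear-expansion {T} LT lo n x s f≈ k =
    trans (T.cong f≈ k) (trans (T.sum lo n (λ j i → x j * s j i) k) (sumFrom-cong lo n (λ j → T.scale (x j) (s j) k)))
    where module T = Linear LT

  ∂ : (ℕ → Carrier) → ℕ → Carrier
  ∂ s k = ι (suc k) * s (suc k)

  ∂-linear : Linear ∂
  ∂-linear = record
    { cong  = λ e k → *-congˡ (e (suc k))
    ; scale = λ x s k → x∙yz≈y∙xz (ι (suc k)) x (s (suc k))
    ; sum   = λ lo n h k → sym (sumFrom-* lo n (ι (suc k)) (λ j → h j (suc k)))
    }

  x∂ : ∀ s k → ι k * s k ≈ shift (∂ s) k
  x∂ s zero    = zeroˡ (s 0)
  x∂ s (suc k) = refl

  ∂² : (ℕ → Carrier) → ℕ → Carrier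
  ∂² s = ∂ (∂ s)

  module LinearPowers (b₀ b₁ : Carrier) where

    y : Poly
    y = b₀ ∷ b₁ ∷ []

    B : ℕ → ℕ → Carrier
    B m = coeff (powP y m)

    B-suc : ∀ m k → B (suc m) k ≈ b₀ * B m k + b₁ * shift (B m) k
    B-suc m = coeff-linear b₀ b₁ (powP y m)

    ∂-pow : ∀ m k → ∂ (B (suc m)) k ≈ ι (suc m) * b₁ * B m k
    ∂-pow zero zero = solve 1 (λ b → (con 1 :+ con 0) :* (b :* con 1 :+ con 0) := (con 1 :+ con 0) :* b :* con 1) refl b₁
    ∂-pow zero (suc k) = solve 2 (λ b K → (con 1 :+ (con 1 :+ K)) :* con 0 := (con 1 :+ con 0) :* b :* con 0) refl b₁ (ι k)
    ∂-pow (suc m) k = begin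
        ι (suc k) * B (suc (suc m)) (suc k)
      ≈⟨ *-congˡ (B-suc (suc m) (suc k)) ⟩
        ι (suc k) * (b₀ * B (suc m) (suc k) + b₁ * B (suc m) k)
      ≈⟨ solve 5 (λ b₀ b₁ K Y Z → (con 1 :+ K) :* (b₀ :* Y :+ b₁ :* Z) := b₀ :* ((con 1 :+ K) :* Y) :+ b₁ :* (K :* Z) :+ b₁ :* Z)
               refl b₀ b₁ (ι k) (B (suc m) (suc k)) (B (suc m) k) ⟩
        b₀ * ∂ (B (suc m)) k + b₁ * (ι k * B (suc m) k) + b₁ * B (suc m) k
      ≈⟨ +-congʳ (+-cong (*-congˡ (∂-pow m k)) (*-congˡ (trans (x∂ (B (suc m)) k) (shift-scaled _ (∂-pow m) k)))) ⟩
        b₀ * (M * b₁ * B m k) + b₁ * (M * b₁ * shift (B m) k) + b₁ * B (suc m) k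
      ≈⟨ +-congʳ (solve 5 (λ b₀ b₁ M Y Z → b₀ :* (M :* b₁ :* Y) :+ b₁ :* (M :* b₁ :* Z) := M :* b₁ :* (b₀ :* Y :+ b₁ :* Z))
                       refl b₀ b₁ M (B m k) (shift (B m) k)) ⟩
        M * b₁ * (b₀ * B m k + b₁ * shift (B m) k) + b₁ * B (suc m) k
      ≈⟨ +-congʳ (*-congˡ (sym (B-suc m k))) ⟩
        M * b₁ * B (suc m) k + b₁ * B (suc m) k
      ≈⟨ solve 3 (λ b M Y → M :* b :* Y :+ b :* Y := (con 1 :+ M) :* b :* Y) refl b₁ M (B (suc m) k) ⟩
        ι (suc (suc m)) * b₁ * B (suc m) k
      ∎
      where
      M : Carrier
      M = ι (suc m)

    ∂²-pow : ∀ m k → ∂² (B (suc (suc m))) k ≈ ι (suc (suc m)) * b₁ * (ι (suc m) * b₁ * B m k)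
    ∂²-pow m k = begin
        ι (suc k) * ∂ (B (suc (suc m))) (suc k)
      ≈⟨ *-congˡ (∂-pow (suc m) (suc k)) ⟩
        ι (suc k) * (ι (suc (suc m)) * b₁ * B (suc m) (suc k))
      ≈⟨ x∙yz≈y∙xz (ι (suc k)) _ _ ⟩
        ι (suc (suc m)) * b₁ * ∂ (B (suc m)) k
      ≈⟨ *-congˡ (∂-pow m k) ⟩
        ι (suc (suc m)) * b₁ * (ι (suc m) * b₁ * B m k)
      ∎

    ∂²-pow-small : ∀ m → m < 2 → ∀ k → ∂² (B m) k ≈ 0#
    ∂²-pow-small zero          _ k = y≈0⇒x*y≈0 _ (zeroʳ _)
    ∂²-pow-small (suc zero)    _ k = y≈0⇒x*y≈0 _ (zeroʳ _)
    ∂²-pow-small (suc (suc m)) (s≤s (s≤s ()))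

    -- The Euler-type operator f ↦ y·f′ (in coefficients).
    𝔼 : (ℕ → Carrier) → ℕ → Carrier
    𝔼 s k = b₁ * (ι k * s k) + b₀ * ∂ s k

    𝔼-linear : Linear 𝔼
    𝔼-linear = record
      { cong  = λ e k → +-cong (*-congˡ (*-congˡ (e k))) (*-congˡ (∂.cong e k))
      ; scale = λ x s k → solve 6 (λ b₀ b₁ x K s₀ s₁ →
                  b₁ :* (K :* (x :* s₀)) :+ b₀ :* ((con 1 :+ K) :* (x :* s₁)) := x :* (b₁ :* (K :* s₀) :+ b₀ :* ((con 1 :+ K) :* s₁)))
                  refl b₀ b₁ x (ι k) (s k) (s (suc k))
      ; sum   = λ lo n h k → begin
            b₁ * (ι k * sumFrom lo n (λ j → h j k)) + b₀ * ∂ (λ i → sumFrom lo n (λ j → h j i)) k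
          ≈⟨ +-cong (*-congˡ (sym (sumFrom-* lo n (ι k) (λ j → h j k)))) (*-congˡ (∂.sum lo n h k)) ⟩
            b₁ * sumFrom lo n (λ j → ι k * h j k) + b₀ * sumFrom lo n (λ j → ∂ (h j) k)
          ≈⟨ sym (+-cong (sumFrom-* lo n b₁ _) (sumFrom-* lo n b₀ _)) ⟩
            sumFrom lo n (λ j → b₁ * (ι k * h j k)) + sumFrom lo n (λ j → b₀ * ∂ (h j) k)
          ≈⟨ sym (sumFrom-+ lo n _ _) ⟩
            sumFrom lo n (λ j → 𝔼 (h j) k)
          ∎
      }
      where module ∂ = Linear ∂-linear

    𝔼-pow : ∀ m k → 𝔼 (B m) k ≈ b₁ * ι m * B m k
    𝔼-pow zero zero = solve 2 (λ b₀ b₁ → b₁ :* (con 0 :* con 1) :+ b₀ :* ((con 1 :+ con 0) :* con 0) := b₁ :* con 0 :* con 1) refl b₀ b₁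
    𝔼-pow zero (suc k) = solve 3 (λ b₀ b₁ K → b₁ :* ((con 1 :+ K) :* con 0) :+ b₀ :* ((con 1 :+ (con 1 :+ K)) :* con 0) := b₁ :* con 0 :* con 0)
                               refl b₀ b₁ (ι k)
    𝔼-pow (suc m) k = begin
        b₁ * (ι k * B (suc m) k) + b₀ * ∂ (B (suc m)) k
      ≈⟨ +-cong (*-congˡ (trans (x∂ (B (suc m)) k) (shift-scaled _ (∂-pow m) k))) (*-congˡ (∂-pow m k)) ⟩
        b₁ * (M * b₁ * shift (B m) k) + b₀ * (M * b₁ * B m k)
      ≈⟨ solve 5 (λ b₀ b₁ M Y Z → b₁ :* (M :* b₁ :* Z) :+ b₀ :* (M :* b₁ :* Y) := b₁ :* M :* (b₀ :* Y :+ b₁ :* Z))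
               refl b₀ b₁ M (B m k) (shift (B m) k) ⟩
        b₁ * M * (b₀ * B m k + b₁ * shift (B m) k)
      ≈⟨ *-congˡ (sym (B-suc m k)) ⟩
        b₁ * M * B (suc m) k
      ∎
      where
      M : Carrier
      M = ι (suc m)

    -- The operator f ↦ y(yf′)′ = y²f″ + b₁yf′, i.e. b₁²·(Y²D″ + YD′) for f = D(Y).
    𝕃 : (ℕ → Carrier) → ℕ → Carrier
    𝕃 s = 𝔼 (𝔼 s)

    𝕃-linear : Linear 𝕃
    𝕃-linear = ∘-linear 𝔼-linear 𝔼-linear

    𝕃-pow : ∀ m k → 𝕃 (B m) k ≈ (b₁ * ι m) * (b₁ * ι m) * B m k
    𝕃-pow m k = begin
        𝔼 (𝔼 (B m)) k
      ≈⟨ 𝔼.cong (𝔼-pow m) k ⟩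
        𝔼 (λ i → b₁ * ι m * B m i) k
      ≈⟨ 𝔼.scale (b₁ * ι m) (B m) k ⟩
        b₁ * ι m * 𝔼 (B m) k
      ≈⟨ *-congˡ (𝔼-pow m k) ⟩
        b₁ * ι m * (b₁ * ι m * B m k)
      ≈⟨ sym (*-assoc _ _ _) ⟩
        (b₁ * ι m) * (b₁ * ι m) * B m k
      ∎
      where module 𝔼 = Linear 𝔼-linear

    𝕃-explicit : ∀ s k → 𝕃 s k ≈ b₁ * b₁ * (ι k * ι k) * s k
                                  + b₁ * b₀ * (ι (suc k) * (ι (suc k) + ι k)) * s (suc k)
                                  + b₀ * b₀ * ∂² s k
    𝕃-explicit s k = solve 6 (λ b₀ b₁ K s₀ s₁ s₂ →
        b₁ :* (K :* (b₁ :* (K :* s₀) :+ b₀ :* ((con 1 :+ K) :* s₁)))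
          :+ b₀ :* ((con 1 :+ K) :* (b₁ :* ((con 1 :+ K) :* s₁) :+ b₀ :* ((con 1 :+ (con 1 :+ K)) :* s₂)))
        := b₁ :* b₁ :* (K :* K) :* s₀ :+ b₁ :* b₀ :* ((con 1 :+ K) :* ((con 1 :+ K) :+ K)) :* s₁
             :+ b₀ :* b₀ :* ((con 1 :+ K) :* ((con 1 :+ (con 1 :+ K)) :* s₂)))
      refl b₀ b₁ (ι k) (s k) (s (suc k)) (s (suc (suc k)))

    -- The Dickson polynomial F = D_N(y, α) satisfies
    --   𝕃 F = (b₁N)²·F + 4α·F″,
    -- the x-form of the classical equation (Y² - 4α)D″ + YD′ = N²D.
    module DicksonEquation (α : Carrier) (N : ℕ) where
      open DicksonCoefficients R using (dicksonCoeff-recurrence)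
      open HalfIndex

      J : ℕ
      J = N ℕ./ 2

      deg : ℕ → ℕ
      deg j = N ∸ 2 ℕ.* j

      w : ℕ → Carrier
      w j = ι (dicksonCoeff N j) * pow (- α) j

      F : ℕ → Carrier
      F = coeff (D N y α)

      F-expansion : ∀ k → F k ≈ sumFrom 0 (suc J) (λ j → w j * B (deg j) k)
      F-expansion k = trans (coeff-sumPFrom 0 (suc J) (λ j → w j ·ₚ powP y (deg j)) k)
                            (sumFrom-cong 0 (suc J) (λ j → coeff-· (w j) (powP y (deg j)) k))

      -- The recurrence satisfied by the weights: for j < J and m = deg (j+1),
      --   w_{j+1}·m² = N²·w_{j+1} + 4α·w_j·(m+2)(m+1),
      -- which is the ratio of consecutive Dickson coefficients read in R.
      weight-recurrence : ∀ j → suc j ≤ J → let m = deg (suc j) in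
        w (suc j) * (ι m * ι m) ≈ ι N * ι N * w (suc j) + four * α * w j * (ι (suc (suc m)) * ι (suc m))
      weight-recurrence j j<J = sym (begin
          ι N * ι N * (δ′ * (- α * ν)) + four * α * (δ * ν) * (ι (suc (suc m)) * ι (suc m))
        ≈⟨ +-congʳ (*-congʳ (*-cong ιN ιN)) ⟩
          (ι m + two * ι (suc j)) * (ι m + two * ι (suc j)) * (δ′ * (- α * ν)) + four * α * (δ * ν) * (ι (suc (suc m)) * ι (suc m))
        ≈⟨ solve 7 (λ M Jj δ′ δ nα a ν →
               (M :+ con 2 :* (con 1 :+ Jj)) :* (M :+ con 2 :* (con 1 :+ Jj)) :* (δ′ :* (nα :* ν))
                 :+ con 4 :* a :* (δ :* ν) :* ((con 1 :+ (con 1 :+ M)) :* (con 1 :+ M))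
               := M :* M :* δ′ :* nα :* ν :+ con 4 :* nα :* ν :* (δ′ :* ((con 1 :+ Jj) :* (con 1 :+ (M :+ Jj))))
                    :+ con 4 :* a :* ν :* (δ :* ((con 1 :+ (con 1 :+ M)) :* (con 1 :+ M))))
             refl (ι m) (ι j) δ′ δ (- α) α ν ⟩
          ι m * ι m * δ′ * - α * ν + four * - α * ν * Hₗ + four * α * ν * (δ * (ι (suc (suc m)) * ι (suc m)))
        ≈⟨ +-congˡ (*-congˡ (sym ratio)) ⟩
          ι m * ι m * δ′ * - α * ν + four * - α * ν * Hₗ + four * α * ν * Hₗ
        ≈⟨ solve 6 (λ M δ′ nα a ν H → M :* M :* δ′ :* nα :* ν :+ con 4 :* nα :* ν :* H :+ con 4 :* a :* ν :* H
                                    := M :* M :* δ′ :* nα :* ν :+ con 4 :* ν :* H :* (nα :+ a))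
             refl (ι m) δ′ (- α) α ν Hₗ ⟩
          ι m * ι m * δ′ * - α * ν + four * ν * Hₗ * (- α + α)
        ≈⟨ +-congˡ (y≈0⇒x*y≈0 _ (-‿inverseˡ α)) ⟩
          ι m * ι m * δ′ * - α * ν + 0#
        ≈⟨ solve 4 (λ M δ′ nα ν → M :* M :* δ′ :* nα :* ν :+ con 0 := δ′ :* (nα :* ν) :* (M :* M)) refl (ι m) δ′ (- α) ν ⟩
          δ′ * (- α * ν) * (ι m * ι m)
        ∎)
        where
        open BelowHalf N j j<J
        two ν δ′ δ Hₗ : Carrier
        two = 1# + 1#
        ν = pow (- α) j
        δ′ = ι (dicksonCoeff N (suc j))
        δ = ι (dicksonCoeff N j)
        Hₗ = δ′ * (ι (suc j) * (1# + (ι m + ι j)))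
        ιN : ι N ≈ ι m + two * ι (suc j)
        ιN = trans (reflexive (P.cong ι N≡m+2[j+1]))
               (trans (ι-+ m (2 ℕ.* suc j)) (+-congˡ (trans (ι-* 2 (suc j)) (*-congʳ (+-congˡ (+-identityʳ 1#))))))
        ratio : Hₗ ≈ δ * (ι (suc (suc m)) * ι (suc m))
        ratio = begin
            δ′ * (ι (suc j) * (1# + (ι m + ι j)))
          ≈⟨ *-congˡ (*-congˡ (+-congˡ (sym (ι-+ m j)))) ⟩
            δ′ * (ι (suc j) * ι (suc (m ℕ.+ j)))
          ≈⟨ sym (trans (ι-* (dicksonCoeff N (suc j)) _) (*-congˡ (ι-* (suc j) (suc (m ℕ.+ j))))) ⟩
            ι (dicksonCoeff N (suc j) ℕ.* (suc j ℕ.* suc (m ℕ.+ j)))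
          ≈⟨ reflexive (P.cong ι (P.subst (λ z → dicksonCoeff z (suc j) ℕ.* (suc j ℕ.* suc (m ℕ.+ j))
                                                ≡ dicksonCoeff z j ℕ.* (suc (suc m) ℕ.* suc m))
                                          (P.sym N≡) (dicksonCoeff-recurrence m j))) ⟩
            ι (dicksonCoeff N j ℕ.* (suc (suc m) ℕ.* suc m))
          ≈⟨ trans (ι-* (dicksonCoeff N j) _) (*-congˡ (ι-* (suc (suc m)) (suc m))) ⟩
            δ * (ι (suc (suc m)) * ι (suc m))
          ∎

      -- 𝕃F = Σ_j w_j·(b₁·deg j)²·y^{deg j}.  By the weight recurrence and the
      -- formula for (y^{m+2})″ the j+1-st term is the j+1-st term of (b₁N)²F plus
      -- the j-th term of 4αF″; the last term of 4αF″ vanishes as deg J < 2.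
      dickson-equation : ∀ k → 𝕃 F k ≈ (b₁ * ι N) * (b₁ * ι N) * F k + four * α * ∂² F k
      dickson-equation k = begin
          𝕃 F k
        ≈⟨ linear-expansion 𝕃-linear 0 (suc J) w (λ j → B (deg j)) F-expansion k ⟩
          sumFrom 0 (suc J) (λ j → w j * 𝕃 (B (deg j)) k)
        ≈⟨ sumFrom-cong 0 (suc J) (λ j → *-congˡ (𝕃-pow (deg j) k)) ⟩
          sumFrom 0 (suc J) u
        ≈⟨ sym (trans (+-congˡ last-vanishes) (+-identityʳ _)) ⟩
          sumFrom 0 (suc J) u + t J
        ≈⟨ sumFrom-telescope J u v t (x∙yz≈y∙xz (w 0) _ _) step ⟩
          sumFrom 0 (suc J) (λ j → v j + t j)
        ≈⟨ trans (sumFrom-+ 0 (suc J) v t) (+-cong (sumFrom-* 0 (suc J) _ _) (sumFrom-* 0 (suc J) _ _)) ⟩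
          c₂ * sumFrom 0 (suc J) (λ j → w j * B (deg j) k) + four * α * sumFrom 0 (suc J) (λ j → w j * ∂² (B (deg j)) k)
        ≈⟨ sym (+-cong (*-congˡ (F-expansion k)) (*-congˡ (linear-expansion ∂²-linear 0 (suc J) w (λ j → B (deg j)) F-expansion k))) ⟩
          c₂ * F k + four * α * ∂² F k
        ∎
        where
        ∂²-linear : Linear ∂²
        ∂²-linear = ∘-linear ∂-linear ∂-linear
        c₂ : Carrier
        c₂ = (b₁ * ι N) * (b₁ * ι N)
        u v t : ℕ → Carrier
        u j = w j * ((b₁ * ι (deg j)) * (b₁ * ι (deg j)) * B (deg j) k)
        v j = c₂ * (w j * B (deg j) k)
        t j = four * α * (w j * ∂² (B (deg j)) k)
        last-vanishes : t J ≈ 0#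
        last-vanishes = y≈0⇒x*y≈0 _ (y≈0⇒x*y≈0 _ (∂²-pow-small (deg J) (remainder<2 N) k))
        step : ∀ j → j < J → u (suc j) ≈ v (suc j) + t j
        step j j<J = begin
            w (suc j) * ((b₁ * ι m) * (b₁ * ι m) * B m k)
          ≈⟨ solve 4 (λ W b M x → W :* ((b :* M) :* (b :* M) :* x) := b :* b :* x :* (W :* (M :* M))) refl (w (suc j)) b₁ (ι m) (B m k) ⟩
            b₁ * b₁ * B m k * (w (suc j) * (ι m * ι m))
          ≈⟨ *-congˡ (weight-recurrence j j<J) ⟩
            b₁ * b₁ * B m k * (ι N * ι N * w (suc j) + four * α * w j * (ι (suc (suc m)) * ι (suc m)))
          ≈⟨ solve 8 (λ b x Nn W′ fa W M₂ M₁ → b :* b :* x :* (Nn :* Nn :* W′ :+ fa :* W :* (M₂ :* M₁))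
                 := (b :* Nn) :* (b :* Nn) :* (W′ :* x) :+ fa :* (W :* (M₂ :* b :* (M₁ :* b :* x))))
               refl b₁ (B m k) (ι N) (w (suc j)) (four * α) (w j) (ι (suc (suc m))) (ι (suc m)) ⟩
            v (suc j) + four * α * (w j * (ι (suc (suc m)) * b₁ * (ι (suc m) * b₁ * B m k)))
          ≈⟨ +-congˡ (*-congˡ (*-congˡ (sym (∂²-pow m k)))) ⟩
            v (suc j) + four * α * (w j * ∂² (B (suc (suc m))) k)
          ≈⟨ +-congˡ (*-congˡ (*-congˡ (reflexive (P.cong (λ d → ∂² (B d) k) (P.sym N∸2j≡m+2))))) ⟩
            v (suc j) + t j
          ∎
          where open BelowHalf N j j<J

  private module Monomial = LinearPowers 0# 1#

  coeff-X^suc : ∀ m k → coeff (powP X (suc m)) k ≈ shift (coeff (powP X m)) k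
  coeff-X^suc m k = trans (Monomial.B-suc m k) (trans (+-cong (zeroˡ _) (*-identityˡ _)) (+-identityˡ _))

  coeff-X^-≢ : ∀ m k → m ≢ k → coeff (powP X m) k ≈ 0#
  coeff-X^-≢ zero    zero    m≢k = ⊥-elim (m≢k P.refl)
  coeff-X^-≢ zero    (suc k) m≢k = refl
  coeff-X^-≢ (suc m) zero    m≢k = coeff-X^suc m zero
  coeff-X^-≢ (suc m) (suc k) m≢k = trans (coeff-X^suc m (suc k)) (coeff-X^-≢ m k (λ e → m≢k (P.cong suc e)))

  coeff-X^-≡ : ∀ m → coeff (powP X m) m ≈ 1#
  coeff-X^-≡ zero    = refl
  coeff-X^-≡ (suc m) = trans (coeff-X^suc m (suc m)) (coeff-X^-≡ m)

  coeff-monomials : ∀ lo len (a : ℕ → Carrier) (n : ℕ → ℕ) k →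
    coeff (sumPFrom lo len (λ i → a i ·ₚ powP X (n i))) k ≈ sumFrom lo len (λ i → a i * coeff (powP X (n i)) k)
  coeff-monomials lo len a n k = trans (coeff-sumPFrom lo len (λ i → a i ·ₚ powP X (n i)) k)
                                       (sumFrom-cong lo len (λ i → coeff-· (a i) (powP X (n i)) k))

  coeff-monomials-absent : ∀ lo len (a : ℕ → Carrier) (n : ℕ → ℕ) k →
    (∀ i → lo ≤ i → i < lo ℕ.+ len → n i ≢ k) →
    coeff (sumPFrom lo len (λ i → a i ·ₚ powP X (n i))) k ≈ 0#
  coeff-monomials-absent lo len a n k absent = trans (coeff-monomials lo len a n k)
    (sumFrom-vanish lo len _ (λ i lo≤i i< → y≈0⇒x*y≈0 (a i) (coeff-X^-≢ (n i) k (absent i lo≤i i<))))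

  coeff-monomials-first : ∀ lo len (a : ℕ → Carrier) (n : ℕ → ℕ) →
    (∀ i → suc lo ≤ i → i < suc lo ℕ.+ len → n i ≢ n lo) →
    coeff (sumPFrom lo (suc len) (λ i → a i ·ₚ powP X (n i))) (n lo) ≈ a lo
  coeff-monomials-first lo len a n unique = trans (coeff-⊕ (a lo ·ₚ powP X (n lo)) _ (n lo))
    (trans (+-cong (trans (coeff-· (a lo) (powP X (n lo)) (n lo)) (trans (*-congˡ (coeff-X^-≡ (n lo))) (*-identityʳ _)))
                   (coeff-monomials-absent (suc lo) len a n (n lo) unique))
           (+-identityʳ _))

  module IntegralDomain (cancel : ∀ {x y} → ¬ x ≈ 0# → x * y ≈ 0# → y ≈ 0#)
                        (char0 : ∀ n → ¬ ι (suc n) ≈ 0#) where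

    mul≉0 : ∀ {x y} → ¬ x ≈ 0# → ¬ y ≈ 0# → ¬ (x * y ≈ 0#)
    mul≉0 x≉0 y≉0 xy≈0 = y≉0 (cancel x≉0 xy≈0)

    cancel-difference : ∀ {x y z} → ¬ x ≈ y → x * z ≈ y * z → z ≈ 0#
    cancel-difference {x} {y} {z} x≉y xz≈yz = cancel x-y≉0 (begin
        (x - y) * z
      ≈⟨ distribʳ z x (- y) ⟩
        x * z + - y * z
      ≈⟨ +-cong xz≈yz (sym (-‿distribˡ-* y z)) ⟩
        y * z - y * z
      ≈⟨ -‿inverseʳ (y * z) ⟩
        0#
      ∎)
      where
      x-y≉0 : ¬ (x - y ≈ 0#)
      x-y≉0 x-y≈0 = x≉y (begin
          x             ≈⟨ sym (+-identityʳ x) ⟩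
          x + 0#        ≈⟨ +-congˡ (sym (-‿inverseˡ y)) ⟩
          x + (- y + y) ≈⟨ sym (+-assoc x (- y) y) ⟩
          (x - y) + y   ≈⟨ +-congʳ x-y≈0 ⟩
          0# + y        ≈⟨ +-identityˡ y ⟩
          y             ∎)

    four≉0 : ¬ four ≈ 0#
    four≉0 four≈0 = char0 3 (trans (solve 0 (con 1 :+ (con 1 :+ (con 1 :+ (con 1 :+ con 0))) := con 4) refl) four≈0)

    module _ (b₀ b₁ α : Carrier) (b₁≉0 : ¬ b₁ ≈ 0#) (α≉0 : ¬ α ≈ 0#) (N : ℕ) where
      open LinearPowers b₀ b₁
      open DicksonEquation α N

      equation-at-zero : ∀ k → F k ≈ 0# →
        b₁ * b₀ * (ι (suc k) * (ι (suc k) + ι k)) * F (suc k) + b₀ * b₀ * ∂² F k ≈ four * α * ∂² F k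
      equation-at-zero k F₀ = begin
          b₁ * b₀ * C * F (suc k) + b₀ * b₀ * ∂² F k
        ≈⟨ +-congʳ (sym (trans (+-congʳ (y≈0⇒x*y≈0 _ F₀)) (+-identityˡ _))) ⟩
          b₁ * b₁ * (ι k * ι k) * F k + b₁ * b₀ * C * F (suc k) + b₀ * b₀ * ∂² F k
        ≈⟨ sym (𝕃-explicit F k) ⟩
          𝕃 F k
        ≈⟨ dickson-equation k ⟩
          (b₁ * ι N) * (b₁ * ι N) * F k + four * α * ∂² F k
        ≈⟨ trans (+-congʳ (y≈0⇒x*y≈0 _ F₀)) (+-identityˡ _) ⟩
          four * α * ∂² F k
        ∎
        where
        C : Carrier
        C = ι (suc k) * (ι (suc k) + ι k)

      ∂²≈0 : ∀ k → ∂² F k ≈ 0# → F (suc (suc k)) ≈ 0#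
      ∂²≈0 k e = cancel (char0 (suc k)) (cancel (char0 k) e)

      zeros-propagate : ¬ (b₀ * b₀ ≈ four * α) → ∀ k → F k ≈ 0# → F (suc k) ≈ 0# → F (suc (suc k)) ≈ 0#
      zeros-propagate Δ≉0 k F₀ F₁ = ∂²≈0 k (cancel-difference Δ≉0 (begin
          b₀ * b₀ * ∂² F k
        ≈⟨ sym (trans (+-congʳ (y≈0⇒x*y≈0 _ F₁)) (+-identityˡ _)) ⟩
          b₁ * b₀ * (ι (suc k) * (ι (suc k) + ι k)) * F (suc k) + b₀ * b₀ * ∂² F k
        ≈⟨ equation-at-zero k F₀ ⟩
          four * α * ∂² F k
        ∎))

      zero-propagates : b₀ * b₀ ≈ four * α → ∀ k → F k ≈ 0# → F (suc k) ≈ 0#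
      zero-propagates Δ≈0 k F₀ = cancel (mul≉0 (mul≉0 b₁≉0 b₀≉0) C≉0) (∙-cancelʳ (four * α * ∂² F k) _ _ (begin
          b₁ * b₀ * C * F (suc k) + four * α * ∂² F k
        ≈⟨ +-congˡ (*-congʳ (sym Δ≈0)) ⟩
          b₁ * b₀ * C * F (suc k) + b₀ * b₀ * ∂² F k
        ≈⟨ equation-at-zero k F₀ ⟩
          four * α * ∂² F k
        ≈⟨ sym (+-identityˡ _) ⟩
          0# + four * α * ∂² F k
        ∎))
        where
        C : Carrier
        C = ι (suc k) * (ι (suc k) + ι k)
        b₀≉0 : ¬ b₀ ≈ 0#
        b₀≉0 b₀≈0 = mul≉0 four≉0 α≉0 (trans (sym Δ≈0) (x≈0⇒x*y≈0 b₀ b₀≈0))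
        C≉0 : ¬ C ≈ 0#
        C≉0 = mul≉0 (char0 k) (λ e → char0 (k ℕ.+ k) (trans (ι-+ (suc k) k) e))

      -- Two consecutive zeros F_k = F_{k+1} = 0 (k ≤ N) propagate up to F_N.
      -- Whether b₀² = 4α is undecidable in general, but since the goal is ⊥
      -- both cases can be refuted separately.
      no-consecutive-zeros : ¬ F N ≈ 0# → ∀ k → k ≤ N → F k ≈ 0# → F (suc k) ≈ 0# → ⊥
      no-consecutive-zeros F_N≉0 k k≤N F₀ F₁ = generic degenerate
        where
        reaches-N : (∀ t → F (t ℕ.+ k) ≈ 0#) → ⊥
        reaches-N zeros = F_N≉0 (P.subst (λ d → F d ≈ 0#) (ℕₚ.m∸n+n≡m k≤N) (zeros (N ∸ k)))
        degenerate : b₀ * b₀ ≈ four * α → ⊥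
        degenerate Δ≈0 = reaches-N zeros
          where
          zeros : ∀ t → F (t ℕ.+ k) ≈ 0#
          zeros zero    = F₀
          zeros (suc t) = zero-propagates Δ≈0 (t ℕ.+ k) (zeros t)
        generic : ¬ (b₀ * b₀ ≈ four * α) → ⊥
        generic Δ≉0 = reaches-N (λ t → proj₁ (zeros t))
          where
          zeros : ∀ t → F (t ℕ.+ k) ≈ 0# × F (suc (t ℕ.+ k)) ≈ 0#
          zeros zero    = F₀ , F₁
          zeros (suc t) = proj₂ (zeros t) , zeros-propagate Δ≉0 (t ℕ.+ k) (proj₁ (zeros t)) (proj₂ (zeros t))

module Exponents where
  open import Data.Nat
  open import Data.Nat.Properties
  open P using (refl; sym; trans; cong; subst)

  extend-decrease : ∀ l (n : ℕ → ℕ) → (∀ i → 1 ≤ i → i < l → n (suc i) < n i) → 1 ≤ n l → n (suc l) ≡ 0 →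
                    ∀ i → 1 ≤ i → i < suc l → n (suc i) < n i
  extend-decrease l n dec nₗ≥1 nₗ₊₁≡0 i 1≤i i<l+1 with m≤n⇒m<n∨m≡n (s≤s⁻¹ i<l+1)
  ... | inj₁ i<l = dec i 1≤i i<l
  ... | inj₂ refl = subst (_< n i) (sym nₗ₊₁≡0) nₗ≥1

  decreasing : ∀ (f : ℕ → ℕ) {lo hi} → (∀ i → lo ≤ i → i < hi → f (suc i) < f i) →
               ∀ p q → lo ≤ p → p < q → q ≤ hi → f q < f p
  decreasing f step p (suc q) lo≤p p<q+1 q+1≤hi with m≤n⇒m<n∨m≡n (s≤s⁻¹ p<q+1)
  ... | inj₂ refl = step p lo≤p q+1≤hi
  ... | inj₁ p<q  = <-trans (step q (≤-trans lo≤p (<⇒≤ p<q)) q+1≤hi)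
                            (decreasing f step p q lo≤p p<q (≤-trans (n≤1+n q) q+1≤hi))

  antitone : ∀ (f : ℕ → ℕ) {lo hi} → (∀ p q → lo ≤ p → p < q → q ≤ hi → f q < f p) →
             ∀ p q → lo ≤ p → p ≤ q → q ≤ hi → f q ≤ f p
  antitone f dec p q lo≤p p≤q q≤hi with m≤n⇒m<n∨m≡n p≤q
  ... | inj₁ p<q  = <⇒≤ (dec p q lo≤p p<q q≤hi)
  ... | inj₂ refl = ≤-refl

  between-values : ∀ (f : ℕ → ℕ) {hi} → (∀ p q → 1 ≤ p → p < q → q ≤ hi → f q < f p) →
                   ∀ i d → 1 ≤ i → suc i ≤ hi → f (suc i) < d → d < f i →
                   ∀ j → 1 ≤ j → j ≤ hi → f j ≢ d
  between-values f dec i d 1≤i i<hi below above j 1≤j j≤hi fj≡d with ≤-<-connex j i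
  ... | inj₁ j≤i = <-irrefl (sym fj≡d) (<-≤-trans above (antitone f dec j i 1≤j j≤i (≤-trans (n≤1+n i) i<hi)))
  ... | inj₂ i<j = <-irrefl fj≡d (≤-<-trans (antitone f dec (suc i) j (s≤s z≤n) i<j j≤hi) below)

  degree-bound : ∀ l (n : ℕ → ℕ) → n (suc l) ≡ 0 →
                 (∀ i → 2 ≤ i → i ≤ suc l → n (i ∸ 1) ≤ n i + 2) → n 1 ≤ 2 * l
  degree-bound l n nₗ₊₁≡0 gaps = subst (λ i → n i ≤ 2 * l) (m+n∸n≡m 1 l) (bound l ≤-refl)
    where
    bound : ∀ d → d ≤ l → n (suc l ∸ d) ≤ 2 * d
    bound zero    _   = subst (_≤ 0) (sym nₗ₊₁≡0) z≤n
    bound (suc d) d<l = begin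
        n (suc l ∸ suc d)
      ≡⟨ cong n (sym index) ⟩
        n (suc l ∸ d ∸ 1)
      ≤⟨ gaps (suc l ∸ d) two≤ (m∸n≤m (suc l) d) ⟩
        n (suc l ∸ d) + 2
      ≤⟨ +-monoˡ-≤ 2 (bound d (≤-trans (n≤1+n d) d<l)) ⟩
        2 * d + 2
      ≡⟨ trans (+-comm (2 * d) 2) (sym (*-distribˡ-+ 2 1 d)) ⟩
        2 * suc d
      ∎
      where
      open ≤-Reasoning
      index : suc l ∸ d ∸ 1 ≡ suc l ∸ suc d
      index = trans (∸-+-assoc (suc l) d 1) (cong (suc l ∸_) (+-comm d 1))
      two≤ : 2 ≤ suc l ∸ d
      two≤ = subst (_≤ suc l ∸ d) (m+n∸n≡m 2 d) (∸-monoˡ-≤ d (s≤s d<l))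

module MonomialEquation {c ℓ′} (K : NumberField c ℓ′) where
  open NumberField K hiding (zero)
  open Over commRing
  open RingTheory commRing
  open import Relation.Binary.Reasoning.Setoid setoid
  open Exponents

  cancel : ∀ {x y} → ¬ x ≈ 0# → x * y ≈ 0# → y ≈ 0#
  cancel {x} {y} x≉0 xy≈0 = begin
      y                ≈⟨ sym (*-identityˡ y) ⟩
      1# * y           ≈⟨ *-congʳ (sym (trans (*-comm _ _) (inverseʳ x x≉0))) ⟩
      (x ⁻¹ * x) * y   ≈⟨ *-assoc _ _ _ ⟩
      x ⁻¹ * (x * y)   ≈⟨ y≈0⇒x*y≈0 _ xy≈0 ⟩
      0#               ∎

  open IntegralDomain cancel char0

  -- If Σ_{i=1}^{l+1} a_i x^{n_i} = e₁·D_{n₁}(b₀ + b₁x, α) + e₀ with strictly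
  -- decreasing exponents, a₁, e₁, b₁, α ≠ 0, then consecutive exponents differ
  -- by at most 2: a larger gap would give two consecutive vanishing
  -- coefficients of the Dickson polynomial below its nonzero leading one.
  exponent-gaps : ∀ l (n : ℕ → ℕ) → (∀ p q → 1 ≤ p → p < q → q ≤ suc l → n q < n p) →
    (a : ℕ → Carrier) → ¬ a 1 ≈ 0# →
    (e₁ e₀ b₀ b₁ α : Carrier) → ¬ e₁ ≈ 0# → ¬ b₁ ≈ 0# → ¬ α ≈ 0# →
    sumP 1 (suc l) (λ i → a i ·ₚ powP X (n i)) ≈ₚ ((e₁ ·ₚ D (n 1) (b₀ ∷ b₁ ∷ []) α) ⊕ constP e₀) →
    ∀ i → 2 ≤ i → i ≤ suc l → n (i ∸ 1) ≤ n i ℕ.+ 2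
  exponent-gaps l n dec a a₁≉0 e₁ e₀ b₀ b₁ α e₁≉0 b₁≉0 α≉0 eq (suc i) (s≤s 1≤i) i<l+1 =
    decidable-stable (n i ℕₚ.≤? n (suc i) ℕ.+ 2)
      (λ ¬small → no-wide-gap (P.subst (_< n i) (ℕₚ.+-comm (n (suc i)) 2) (ℕₚ.≰⇒> ¬small)))
    where
    N : ℕ
    N = n 1
    open LinearPowers b₀ b₁
    open DicksonEquation α N

    n[i]≤N : n i ≤ N
    n[i]≤N = antitone n dec 1 i ℕₚ.≤-refl 1≤i (ℕₚ.≤-trans (ℕₚ.n≤1+n i) i<l+1)

    G : ℕ → Carrier
    G = coeff (sumP 1 (suc l) (λ i → a i ·ₚ powP X (n i)))

    G≈e₁F : ∀ k → 1 ≤ k → G k ≈ e₁ * F k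
    G≈e₁F (suc k) _ = trans (eq (suc k)) (trans (coeff-⊕ (e₁ ·ₚ D N y α) (constP e₀) (suc k))
                                               (trans (+-identityʳ _) (coeff-· e₁ (D N y α) (suc k))))

    leading≉0 : 1 ≤ N → ¬ F N ≈ 0#
    leading≉0 1≤N F_N≈0 = a₁≉0 (begin
        a 1      ≈⟨ sym (coeff-monomials-first 1 l a n (λ j 2≤j j<2+l → ℕₚ.<⇒≢ (dec 1 j ℕₚ.≤-refl 2≤j (ℕₚ.≤-pred j<2+l)))) ⟩
        G N      ≈⟨ G≈e₁F N 1≤N ⟩
        e₁ * F N ≈⟨ y≈0⇒x*y≈0 e₁ F_N≈0 ⟩
        0#       ∎)

    F-vanishes : ∀ k → n (suc i) < suc k → suc k < n i → F (suc k) ≈ 0#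
    F-vanishes k below above = cancel e₁≉0 (trans (sym (G≈e₁F (suc k) (s≤s z≤n)))
      (coeff-monomials-absent 1 (suc l) a n (suc k)
        (λ j 1≤j j<l+2 → between-values n dec i (suc k) 1≤i i<l+1 below above j 1≤j (ℕₚ.≤-pred j<l+2))))

    -- n_i > n_{i+1} + 2 leaves the degrees n_{i+1} + 1 and n_{i+1} + 2 without monomial.
    no-wide-gap : 2 ℕ.+ n (suc i) < n i → ⊥
    no-wide-gap wide = no-consecutive-zeros b₀ b₁ α b₁≉0 α≉0 N (leading≉0 (ℕₚ.≤-trans (s≤s z≤n) k≤N)) k k≤N
                         (F-vanishes (n (suc i)) (ℕₚ.n<1+n _) (ℕₚ.<-trans (ℕₚ.n<1+n _) wide))
                         (F-vanishes k (ℕₚ.<-trans (ℕₚ.n<1+n _) (ℕₚ.n<1+n _)) wide)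
      where
      k : ℕ
      k = suc (n (suc i))
      k≤N : k ≤ N
      k≤N = ℕₚ.≤-trans (ℕₚ.<⇒≤ (ℕₚ.<-trans (ℕₚ.n<1+n _) wide)) n[i]≤N

lemma4p2 : ∀ {c ℓ′} (K : NumberField c ℓ′) →
  let open NumberField K
      open Over commRing
  in (l : ℕ) → 2 ≤ l →
     (n : ℕ → ℕ) →
     (∀ i → 1 ≤ i → i < l → n (suc i) < n i) →
     1 ≤ n l →
     n (suc l) ≡ 0 →
     (a : ℕ → Carrier) →
     ¬ (prod 1 l a ≈ 0#) →
     (e₁ e₀ c₁ c₀ α : Carrier) →
     ¬ (e₁ * c₁ * α ≈ 0#) →
     sumP 1 (suc l) (λ i → a i ·ₚ powP X (n i))
       ≈ₚ ((e₁ ·ₚ D (n 1) ((c₁ ·ₚ X) ⊕ constP c₀) α) ⊕ constP e₀) →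
     (∀ i → 2 ≤ i → i ≤ suc l → n (i ∸ 1) ≤ n i ℕ.+ 2) × (n 1 ≤ 2 ℕ.* l)
lemma4p2 K l 2≤l n dec nₗ≥1 nₗ₊₁≡0 a ∏a≉0 e₁ e₀ c₁ c₀ α e₁c₁α≉0 eq = gaps , degree-bound l n nₗ₊₁≡0 gaps
  where
  open NumberField K
  open RingTheory commRing using (factors≉0; prodFrom-head≈0)
  open MonomialEquation K using (exponent-gaps)
  open Exponents

  a₁≉0 : ¬ a 1 ≈ 0#
  a₁≉0 a₁≈0 = ∏a≉0 (prodFrom-head≈0 1 l a (ℕₚ.≤-trans (s≤s z≤n) 2≤l) a₁≈0)

  e₁c₁≉0 : ¬ e₁ * c₁ ≈ 0#
  e₁c₁≉0 = proj₁ (factors≉0 e₁c₁α≉0)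

  e₁≉0 : ¬ e₁ ≈ 0#
  e₁≉0 = proj₁ (factors≉0 e₁c₁≉0)

  -- b₁ = c₁·1 below.
  b₁≉0 : ¬ c₁ * 1# ≈ 0#
  b₁≉0 b₁≈0 = proj₂ (factors≉0 e₁c₁≉0) (trans (sym (*-identityʳ c₁)) b₁≈0)

  α≉0 : ¬ α ≈ 0#
  α≉0 = proj₂ (factors≉0 e₁c₁α≉0)

  -- c₁·x + c₀ is definitionally the list b₀ ∷ b₁ ∷ [] with b₀ = c₁·0 + c₀ and
  -- b₁ = c₁·1, so the hypothesis eq applies as it stands.
  gaps : ∀ i → 2 ≤ i → i ≤ suc l → n (i ∸ 1) ≤ n i ℕ.+ 2
  gaps = exponent-gaps l n (decreasing n (extend-decrease l n dec nₗ≥1 nₗ₊₁≡0)) a a₁≉0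
                       e₁ e₀ (c₁ * 0# + c₀) (c₁ * 1#) α e₁≉0 b₁≉0 α≉0 eq
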